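{- Let $R$ be an impartial ruleset (in which every play terminates) where the options of any position $x$ are exactly the values $f_j(x)$ for $j\in I$ with $x\in\operatorname{dom} f_j$, for a family of partial functions $\{f_j\}_{j\in I}$. Suppose there is $i\in I$ such that (a) for all $j\in I$, $f_i\circ f_j=f_j\circ f_i$ whenever both are defined; and (b) for every position $x$ such that $f_i(x)$ is defined and every $j\in I$ with $j\neq i$: $f_j(x)$ is defined $\iff$ $f_j(f_i(x))$ is defined $\iff$ $f_i(f_j(x))$ is defined. Then $R$ is nim-periodic in $f_i$, i.e. $\mathcal{SG}(f_i(x))=\mathcal{SG}(x)\oplus 1$ for all $x\in\operatorname{dom} f_i$.
   Context: $\mathcal{SG}$ denotes the Sprague–Grundy value and $\oplus$ nim-addition (bitwise XOR). -}

module Defs where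

open import Data.Nat using (ℕ; zero; suc; _+_; _*_; _<_; _%_; _/_)
open import Data.Bool using (Bool; true; false; _xor_)
open import Data.Maybe using (Maybe; just; nothing)
open import Data.Product using (Σ; ∃; _×_; _,_)
open import Relation.Binary.PropositionalEquality using (_≡_; _≢_)
open import Induction.WellFounded using (WellFounded)
open import Function.Bundles using (_⇔_)

-- Nim-addition (bitwise XOR) on ℕ.  'xorFuel k m n' processes k binary digits;
-- k = m + n digits always suffice, since m, n < 2 ^ (m + n).
bit : ℕ → Bool
bit n = n % 2 Data.Nat.≡ᵇ 1

fromBit : Bool → ℕ
fromBit true  = 1
fromBit false = 0

xorFuel : ℕ → ℕ → ℕ → ℕ
xorFuel zero    m n = 0
xorFuel (suc k) m n = fromBit (bit m xor bit n) + 2 * xorFuel k (m / 2) (n / 2)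

infixl 6 _⊕_
_⊕_ : ℕ → ℕ → ℕ
m ⊕ n = xorFuel (m + n) m n

Option : {P I : Set} → (I → P → Maybe P) → P → P → Set
Option {I = I} f y x = ∃ λ (j : I) → f j x ≡ just y

Defined : {P : Set} → (P → Maybe P) → P → Set
Defined {P} g x = Σ P λ y → g x ≡ just y

CompDefined : {P : Set} → (P → Maybe P) → (P → Maybe P) → P → Set
CompDefined {P} g h x = Σ P λ y → h x ≡ just y × Defined g y

IsSG : {P I : Set} → (I → P → Maybe P) → (P → ℕ) → Set
IsSG {P} f g = ∀ (x : P) →
  (∀ y → Option f y x → g y ≢ g x) ×
  (∀ k → k < g x → Σ P λ y → Option f y x × g y ≡ k)

Commutes : {P : Set} → (P → Maybe P) → (P → Maybe P) → Set
Commutes {P} g h = ∀ (x y z u w : P) →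
  h x ≡ just y → g y ≡ just z →
  g x ≡ just u → h u ≡ just w → z ≡ w

DomainCondition : {P I : Set} → (I → P → Maybe P) → I → Set
DomainCondition {P} {I} f i = ∀ (x y : P) → f i x ≡ just y → ∀ (j : I) → j ≢ i →
  (Defined (f j) x ⇔ Defined (f j) y) × (Defined (f j) y ⇔ CompDefined (f i) (f j) x)

{-# OPTIONS --safe #-}
module Submission where

open import Defs
open import Data.Nat using (ℕ; zero; suc; _+_; _*_; _/_; _≤_; _<_; z≤n; s≤s; s≤s⁻¹)
open import Data.Nat.Properties
  using (suc-injective; <-cmp; ≤-trans; +-comm; +-suc; *-suc)
open import Data.Nat.DivMod using (m/n≤m; m/n<m; m/n≡1+[m∸n]/n)
open import Data.Bool using (true; false; not; _xor_)
open import Data.Bool.Properties using (xor-identityʳ; xor-comm)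
open import Data.Maybe using (Maybe; just)
open import Data.Maybe.Properties using (just-injective)
open import Data.Product using (Σ; _×_; _,_; proj₁; proj₂)
open import Data.Sum using (_⊎_; inj₁; inj₂)
open import Data.Empty using (⊥-elim)
open import Function.Base using (_∘_)
open import Function.Bundles using (Equivalence)
open import Relation.Binary.Definitions using (tri<; tri≈; tri>)
open import Relation.Binary.PropositionalEquality
  using (_≡_; _≢_; refl; sym; trans; cong; cong₂; subst; module ≡-Reasoning)
open import Relation.Unary using (Pred; _∈_; _∉_)
open import Induction.WellFounded using (WellFounded; Acc; acc)

-- Write y = f i x and toggle n = n ⊕ 1.  For j ≢ i, (a) and (b) make the
-- options f j x of x and f j y of y the corners of commuting squares
-- f i (f j x) = f j y, so by well-founded induction the SG values of the
-- options of y are the toggles of those of x, except that y (an option of x)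
-- and f i y (an option of y) may be unmatched.  Any two sets of naturals
-- related in this way have mexes a and b with b = toggle a (toggle-mex).

toggle : ℕ → ℕ
toggle zero          = 1
toggle (suc zero)    = 0
toggle (suc (suc n)) = suc (suc (toggle n))

toggle-involutive : ∀ n → toggle (toggle n) ≡ n
toggle-involutive zero          = refl
toggle-involutive (suc zero)    = refl
toggle-involutive (suc (suc n)) = cong (λ m → suc (suc m)) (toggle-involutive n)

toggle-injective : ∀ {m n} → toggle m ≡ toggle n → m ≡ n
toggle-injective {m} {n} eq = begin
  m                 ≡⟨ sym (toggle-involutive m) ⟩
  toggle (toggle m) ≡⟨ cong toggle eq ⟩
  toggle (toggle n) ≡⟨ toggle-involutive n ⟩
  n                 ∎
  where open ≡-Reasoning

toggle-irreflexive : ∀ n → toggle n ≢ n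
toggle-irreflexive zero          ()
toggle-irreflexive (suc zero)    ()
toggle-irreflexive (suc (suc n)) eq =
  toggle-irreflexive n (suc-injective (suc-injective eq))

<toggle⇒toggle< : ∀ {m n} → m < toggle n → m ≢ n → toggle m < n
<toggle⇒toggle< {zero}        {zero}        _ m≢n = ⊥-elim (m≢n refl)
<toggle⇒toggle< {zero}        {suc (suc n)} _ _   = s≤s (s≤s z≤n)
<toggle⇒toggle< {suc zero}    {suc (suc n)} _ _   = s≤s z≤n
<toggle⇒toggle< {suc (suc m)} {suc (suc n)} (s≤s (s≤s m<n)) m≢n =
  s≤s (s≤s (<toggle⇒toggle< m<n (λ m≡n → m≢n (cong (λ k → suc (suc k)) m≡n))))
<toggle⇒toggle< {suc _}       {zero}        (s≤s ())
<toggle⇒toggle< {_}           {suc zero}    ()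

toggle-trichotomy : ∀ {m n} → m ≢ n → n ≡ toggle m ⊎ toggle n < m ⊎ toggle m < n
toggle-trichotomy {m} {n} m≢n with <-cmp m (toggle n)
... | tri≈ _ m≡tn _ = inj₁ (trans (sym (toggle-involutive n)) (cong toggle (sym m≡tn)))
... | tri> _ _ tn<m = inj₂ (inj₁ tn<m)
... | tri< m<tn _ _ = inj₂ (inj₂ (<toggle⇒toggle< m<tn m≢n))

IsMex : Pred ℕ _ → ℕ → Set
IsMex A a = a ∉ A × (∀ {k} → k < a → k ∈ A)

toggle-mex : ∀ {A B : Pred ℕ _} {a b} → IsMex A a → IsMex B b → b ∈ A →
  (∀ {k} → k ∈ A → k ≢ b → toggle k ∈ B) →
  (∀ {k} → k ∈ B → k ≢ toggle b → toggle k ∈ A) →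
  b ≡ toggle a
toggle-mex {A} {B} {a} {b} (a∉A , below-a) (b∉B , below-b) b∈A A→B B→A =
  by-cases (toggle-trichotomy a≢b)
  where
  a≢b : a ≢ b
  a≢b refl = a∉A b∈A

  by-cases : b ≡ toggle a ⊎ toggle b < a ⊎ toggle a < b → b ≡ toggle a
  by-cases (inj₁ b≡ta) = b≡ta
  by-cases (inj₂ (inj₁ tb<a)) = ⊥-elim (b∉B (subst (_∈ B) (toggle-involutive b)
    (A→B (below-a tb<a) (toggle-irreflexive b))))
  by-cases (inj₂ (inj₂ ta<b)) = ⊥-elim (a∉A (subst (_∈ A) (toggle-involutive a)
    (B→A (below-b ta<b) (a≢b ∘ toggle-injective))))

+2*half-suc-suc : ∀ c n → c + 2 * (suc (suc n) / 2) ≡ suc (suc (c + 2 * (n / 2)))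
+2*half-suc-suc c n = begin
  c + 2 * (suc (suc n) / 2)     ≡⟨ cong (λ q → c + 2 * q) (m/n≡1+[m∸n]/n {suc (suc n)} {2} 2≤2+n) ⟩
  c + 2 * suc (n / 2)           ≡⟨ cong (c +_) (*-suc 2 (n / 2)) ⟩
  c + suc (suc (2 * (n / 2)))   ≡⟨ +-suc c (suc (2 * (n / 2))) ⟩
  suc (c + suc (2 * (n / 2)))   ≡⟨ cong suc (+-suc c (2 * (n / 2))) ⟩
  suc (suc (c + 2 * (n / 2)))   ∎
  where
  open ≡-Reasoning
  2≤2+n : 2 ≤ suc (suc n)
  2≤2+n = s≤s (s≤s z≤n)

bit+2*half : ∀ n → fromBit (bit n) + 2 * (n / 2) ≡ n
bit+2*half zero          = refl
bit+2*half (suc zero)    = refl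
bit+2*half (suc (suc n)) =
  trans (+2*half-suc-suc (fromBit (bit n)) n) (cong (λ m → suc (suc m)) (bit+2*half n))

notBit+2*half : ∀ n → fromBit (not (bit n)) + 2 * (n / 2) ≡ toggle n
notBit+2*half zero          = refl
notBit+2*half (suc zero)    = refl
notBit+2*half (suc (suc n)) =
  trans (+2*half-suc-suc (fromBit (not (bit n))) n) (cong (λ m → suc (suc m)) (notBit+2*half n))

xorFuel-identityʳ : ∀ k {m} → m ≤ k → xorFuel k m 0 ≡ m
xorFuel-identityʳ zero    z≤n = refl
xorFuel-identityʳ (suc k) {m} m≤1+k = begin
  fromBit (bit m xor false) + 2 * xorFuel k (m / 2) 0 ≡⟨ cong₂ (λ c q → fromBit c + 2 * q)
                                                           (xor-identityʳ (bit m))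
                                                           (xorFuel-identityʳ k (half≤ m≤1+k)) ⟩
  fromBit (bit m) + 2 * (m / 2)                       ≡⟨ bit+2*half m ⟩
  m                                                   ∎
  where
  open ≡-Reasoning
  half≤ : ∀ {m} → m ≤ suc k → m / 2 ≤ k
  half≤ {zero}  _         = z≤n
  half≤ {suc m} (s≤s m≤k) = ≤-trans (s≤s⁻¹ (m/n<m (suc m) 2 (s≤s (s≤s z≤n)))) m≤k

⊕1≡toggle : ∀ n → n ⊕ 1 ≡ toggle n
⊕1≡toggle n = begin
  xorFuel (n + 1) n 1                                ≡⟨ cong (λ k → xorFuel k n 1) (+-comm n 1) ⟩
  fromBit (bit n xor true) + 2 * xorFuel n (n / 2) 0 ≡⟨ cong₂ (λ c q → fromBit c + 2 * q)
                                                           (xor-comm (bit n) true)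
                                                           (xorFuel-identityʳ n (m/n≤m n 2)) ⟩
  fromBit (not (bit n)) + 2 * (n / 2)                ≡⟨ notBit+2*half n ⟩
  toggle n                                           ∎
  where open ≡-Reasoning

module _ {P I : Set} (f : I → P → Maybe P) (g : P → ℕ) where

  OptionValues : P → Pred ℕ _
  OptionValues x k = Σ P λ o → Option f o x × g o ≡ k

  IsSG⇒IsMex : IsSG f g → ∀ x → IsMex (OptionValues x) (g x)
  IsSG⇒IsMex sg x = (λ (o , o-opt , go≡gx) → proj₁ (sg x) o o-opt go≡gx)
                  , (λ {k} k<gx → proj₂ (sg x) k k<gx)

module _ {P I : Set} (f : I → P → Maybe P) (i : I)
  (commute : ∀ j → Commutes (f i) (f j)) (domain : DomainCondition f i) where

  square-from-option-of-y : ∀ {x y u j} → f i x ≡ just y → j ≢ i → f j y ≡ just u →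
    Σ P λ o → f j x ≡ just o × f i o ≡ just u
  square-from-option-of-y {x} {y} {u} {j} fix j≢i fjy
    with Equivalence.to (proj₂ (domain x y fix j j≢i)) (u , fjy)
  ... | o , fjx , z , fio =
    o , fjx , subst (λ w → f i o ≡ just w) (commute j x o z y u fjx fio fix fjy) fio

  square-from-option-of-x : ∀ {x y o j} → f i x ≡ just y → j ≢ i → f j x ≡ just o →
    Σ P λ u → f j y ≡ just u × f i o ≡ just u
  square-from-option-of-x {x} {y} {o} {j} fix j≢i fjx
    with Equivalence.to (proj₁ (domain x y fix j j≢i)) (o , fjx)
  ... | u , fjy with square-from-option-of-y fix j≢i fjy
  ... | o′ , fjx′ , fio′ with refl ← just-injective (trans (sym fjx) fjx′) = u , fjy , fio′

  module _ (g : P → ℕ) (sg : IsSG f g) where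

    nim-periodic : ∀ x → Acc (Option f) x → ∀ {y} → f i x ≡ just y → g y ≡ toggle (g x)
    nim-periodic x (acc rs) {y} fix =
      toggle-mex (IsSG⇒IsMex f g sg x) (IsSG⇒IsMex f g sg y) (y , (i , fix) , refl)
                 forward backward
      where
      IH : ∀ {o z} → Option f o x → f i o ≡ just z → g z ≡ toggle (g o)
      IH o-opt = nim-periodic _ (rs o-opt)

      forward : ∀ {k} → k ∈ OptionValues f g x → k ≢ g y → toggle k ∈ OptionValues f g y
      forward (o , (j , fjx) , refl) go≢gy =
        let u , fjy , fio = square-from-option-of-x fix j≢i fjx
        in  u , (j , fjy) , IH (j , fjx) fio
        where
        j≢i : j ≢ i
        j≢i refl = go≢gy (cong g (just-injective (trans (sym fjx) fix)))

      backward : ∀ {k} → k ∈ OptionValues f g y → k ≢ toggle (g y) → toggle k ∈ OptionValues f g x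
      backward (u , (j , fjy) , refl) gu≢tgy =
        let o , fjx , fio = square-from-option-of-y fix j≢i fjy
        in  o , (j , fjx) , trans (sym (toggle-involutive (g o))) (cong toggle (sym (IH (j , fjx) fio)))
        where
        j≢i : j ≢ i
        j≢i refl = gu≢tgy (IH (i , fix) fjy)

mainTheorem14 : (P I : Set) (f : I → P → Maybe P) →
    WellFounded (Option f) →
    (g : P → ℕ) → IsSG f g →
    (i : I) →
    (∀ j → Commutes (f i) (f j)) →
    DomainCondition f i →
    ∀ (x y : P) → f i x ≡ just y → g y ≡ g x ⊕ 1
mainTheorem14 P I f wf g sg i commute domain x y fix =
  trans (nim-periodic f i commute domain g sg x (wf x) fix) (sym (⊕1≡toggle (g x)))
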